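{- For all integers $0\le k\le n$, the Bernoulli polynomials satisfy \[ \sum_{j=0}^{n-k}\binom{n-k}{j}B_{j+k}(x)=\sum_{j=0}^{k}\binom{k}{j}(-1)^{j}B_{n-j}(x)+\bigl(nx-(n-k)\bigr)x^{n-k-1}(x-1)^{k-1}, \] as an identity of rational functions in the indeterminate $x$ (the last term being a polynomial after cancellation).
   Context: The Bernoulli polynomials $B_n(x)$ are defined by $\frac{t e^{xt}}{e^t-1}=\sum_{n\ge0}B_n(x)\frac{t^n}{n!}$. -}

module Defs where

open import Data.Nat as ℕ using (ℕ; zero; suc)
open import Data.Nat.Combinatorics using (_C_)
open import Data.Integer as ℤ using (ℤ; +_; -[1+_])
open import Data.Rational using (ℚ; 0ℚ; 1ℚ; _+_; _*_; _-_; -_; 1/_; _/_; NonZero)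
open import Data.Vec using (Vec; []; _∷_; lookup; head)
open import Data.Fin using (Fin)

ℕ→ℚ : ℕ → ℚ
ℕ→ℚ n = + n / 1

_^_ : ℚ → ℕ → ℚ
x ^ zero  = 1ℚ
x ^ suc m = x * (x ^ m)

zpow : (x : ℚ) → .{{NonZero x}} → ℤ → ℚ
zpow x (+ m)      = x ^ m
zpow x -[1+ m ]   = (1/ x) ^ suc m

sumTo : ℕ → (ℕ → ℚ) → ℚ
sumTo zero    f = f 0
sumTo (suc m) f = sumTo m f + f (suc m)

sgn : ℕ → ℚ
sgn zero    = 1ℚ
sgn (suc j) = - sgn j

-- Comparing coefficients of t^m/m! (m ≥ 1) in
--   t e^{xt} = (e^t - 1) · Σ_n B_n(x) t^n/n!
-- gives  m x^{m-1} = Σ_{j=0}^{m-1} C(m,j) B_j(x),  i.e. (with m = n+2)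
--   B_0(x) = 1,
--   B_{n+1}(x) = x^{n+1} - (1/(n+2)) Σ_{j=0}^{n} C(n+2,j) B_j(x).
-- BVec n x = [B_n(x), B_{n-1}(x), …, B_0(x)].
-- wsum N n [b_n,…,b_0] = Σ_{j=0}^{n} C(N,j) b_j
wsum : ℕ → (n : ℕ) → Vec ℚ (suc n) → ℚ
wsum N zero    (b ∷ [])     = ℕ→ℚ (N C 0) * b
wsum N (suc n) (b ∷ bs)     = ℕ→ℚ (N C suc n) * b + wsum N n bs

BVec : (n : ℕ) → ℚ → Vec ℚ (suc n)
BVec zero    x = 1ℚ ∷ []
BVec (suc n) x =
  (x ^ suc n - (+ 1 / suc (suc n)) * wsum (suc (suc n)) n (BVec n x)) ∷ BVec n x

B : ℕ → ℚ → ℚ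
B n x = head (BVec n x)

{-# OPTIONS --safe #-}
-- Write L(n,k), R(n,k) and E(n,k) for the left-hand sum, the alternating sum and the
-- correction term. All three satisfy the Pascal-type recurrence
--   F(n+1,k+1) = F(n+1,k) − F(n,k)
-- (for the binomial sums by Pascal's rule, for E by direct algebra), so by induction on k
-- it suffices to treat k = 0. There L(n,0) − B_n(x) = Σ_{j<n} C(n,j) B_j(x) = n x^{n−1},
-- which is the defining recurrence of the Bernoulli polynomials, and E(n,0) = n x^{n−1}.
module Submission where

open import Defs
open import Data.Nat as ℕ using (ℕ; zero; suc; _≤_; _∸_; s≤s)
import Data.Nat.Properties as ℕP
open import Data.Nat.Combinatorics using (_C_; k>n⇒nCk≡0; nCk+nC[k+1]≡[n+1]C[k+1]; nCk≡nC[n∸k]; nC1≡n; nCn≡1)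
import Data.Nat
import Data.Integer
open import Data.Integer as ℤ using (+_)
import Data.Integer.Properties as ℤP
open import Data.Rational using (ℚ; 0ℚ; 1ℚ; _+_; _*_; _-_; -_; 1/_; _/_; NonZero; toℚᵘ)
open import Data.Rational.Properties as ℚP using (toℚᵘ-injective; toℚᵘ-fromℚᵘ; toℚᵘ-homo-+; toℚᵘ-homo-*)
import Data.Rational.Unnormalised as ℚᵘ
import Data.Rational.Unnormalised.Properties as ℚᵘP
open import Relation.Nullary.Decidable.Core using (dec⇒maybe)
open import Level using (0ℓ)
open import Relation.Binary.PropositionalEquality
open import Tactic.RingSolver using (solve-∀)
import Tactic.RingSolver.Core.AlmostCommutativeRing as ACR

ℚ-ring : ACR.AlmostCommutativeRing 0ℓ 0ℓ
ℚ-ring = ACR.fromCommutativeRing ℚP.+-*-commutativeRing (λ p → dec⇒maybe (0ℚ ℚP.≟ p))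

toℚᵘ-ℕ→ℚ : ∀ n → toℚᵘ (ℕ→ℚ n) ℚᵘ.≃ ℚᵘ.mkℚᵘ (+ n) 0
toℚᵘ-ℕ→ℚ n = toℚᵘ-fromℚᵘ (ℚᵘ.mkℚᵘ (+ n) 0)

ℕ→ℚ-+ : ∀ a b → ℕ→ℚ (a ℕ.+ b) ≡ ℕ→ℚ a + ℕ→ℚ b
ℕ→ℚ-+ a b = toℚᵘ-injective (begin
  toℚᵘ (ℕ→ℚ (a ℕ.+ b))                 ≈⟨ toℚᵘ-ℕ→ℚ (a ℕ.+ b) ⟩
  ℚᵘ.mkℚᵘ (+ (a ℕ.+ b)) 0              ≈⟨ ℚᵘ.*≡* (cong (ℤ._* + 1) numerators) ⟩
  ℚᵘ.mkℚᵘ (+ a) 0 ℚᵘ.+ ℚᵘ.mkℚᵘ (+ b) 0 ≈⟨ ℚᵘP.+-cong (toℚᵘ-ℕ→ℚ a) (toℚᵘ-ℕ→ℚ b) ⟨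
  toℚᵘ (ℕ→ℚ a) ℚᵘ.+ toℚᵘ (ℕ→ℚ b)       ≈⟨ toℚᵘ-homo-+ (ℕ→ℚ a) (ℕ→ℚ b) ⟨
  toℚᵘ (ℕ→ℚ a + ℕ→ℚ b)                 ∎)
  where
  open ℚᵘP.≃-Reasoning
  numerators : + (a ℕ.+ b) ≡ + a ℤ.* + 1 ℤ.+ + b ℤ.* + 1
  numerators = trans (ℤP.pos-+ a b) (sym (cong₂ ℤ._+_ (ℤP.*-identityʳ (+ a)) (ℤP.*-identityʳ (+ b))))

ℕ→ℚ-suc : ∀ n → ℕ→ℚ (suc n) ≡ 1ℚ + ℕ→ℚ n
ℕ→ℚ-suc = ℕ→ℚ-+ 1

ℕ→ℚ-suc-*-inverse : ∀ n → ℕ→ℚ (suc n) * (+ 1 / suc n) ≡ 1ℚ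
ℕ→ℚ-suc-*-inverse n = toℚᵘ-injective (begin
  toℚᵘ (ℕ→ℚ (suc n) * (+ 1 / suc n))         ≈⟨ toℚᵘ-homo-* (ℕ→ℚ (suc n)) (+ 1 / suc n) ⟩
  toℚᵘ (ℕ→ℚ (suc n)) ℚᵘ.* toℚᵘ (+ 1 / suc n) ≈⟨ ℚᵘP.*-cong (toℚᵘ-ℕ→ℚ (suc n)) (toℚᵘ-fromℚᵘ (ℚᵘ.mkℚᵘ (+ 1) n)) ⟩
  ℚᵘ.mkℚᵘ (+ suc n) 0 ℚᵘ.* ℚᵘ.mkℚᵘ (+ 1) n   ≈⟨ ℚᵘP.*-inverseʳ (ℚᵘ.mkℚᵘ (+ suc n) 0) ⟩
  ℚᵘ.1ℚᵘ                                      ∎)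
  where open ℚᵘP.≃-Reasoning

sumTo-cong : ∀ m {f g : ℕ → ℚ} → (∀ j → f j ≡ g j) → sumTo m f ≡ sumTo m g
sumTo-cong zero    f≗g = f≗g 0
sumTo-cong (suc m) f≗g = cong₂ _+_ (sumTo-cong m f≗g) (f≗g (suc m))

sumTo-shift : ∀ m (f : ℕ → ℚ) → sumTo (suc m) f ≡ f 0 + sumTo m (λ j → f (suc j))
sumTo-shift zero    f = refl
sumTo-shift (suc m) f = trans (cong (_+ f (suc (suc m))) (sumTo-shift m f)) (ℚP.+-assoc (f 0) _ _)

sumTo-+ : ∀ m (f g : ℕ → ℚ) → sumTo m (λ j → f j + g j) ≡ sumTo m f + sumTo m g
sumTo-+ zero    f g = refl
sumTo-+ (suc m) f g = trans (cong (_+ (f (suc m) + g (suc m))) (sumTo-+ m f g))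
                            (interchange (sumTo m f) (sumTo m g) (f (suc m)) (g (suc m)))
  where
  interchange : ∀ a b c d → (a + b) + (c + d) ≡ (a + c) + (b + d)
  interchange = solve-∀ ℚ-ring

sumTo-neg : ∀ m (f : ℕ → ℚ) → sumTo m (λ j → - f j) ≡ - sumTo m f
sumTo-neg zero    f = refl
sumTo-neg (suc m) f = trans (cong (_+ (- f (suc m))) (sumTo-neg m f))
                            (sym (ℚP.neg-distrib-+ (sumTo m f) (f (suc m))))

sumTo-pascal : ∀ m (g : ℕ → ℚ) →
  sumTo (suc m) (λ j → ℕ→ℚ (suc m C j) * g j)
    ≡ sumTo m (λ j → ℕ→ℚ (m C j) * g j) + sumTo m (λ j → ℕ→ℚ (m C j) * g (suc j))
sumTo-pascal m g = begin
  sumTo (suc m) (λ j → ℕ→ℚ (suc m C j) * g j)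
    ≡⟨ sumTo-shift m _ ⟩
  g′ 0 + sumTo m (λ j → ℕ→ℚ (suc m C suc j) * g (suc j))
    ≡⟨ cong (λ t → g′ 0 + t) (trans (sumTo-cong m pascal-term) (sumTo-+ m _ _)) ⟩
  g′ 0 + (T + sumTo m (λ j → g′ (suc j)))
    ≡⟨ rearrange (g′ 0) T (sumTo m (λ j → g′ (suc j))) ⟩
  (g′ 0 + sumTo m (λ j → g′ (suc j))) + T
    ≡⟨ cong (_+ T) (sym (sumTo-shift m g′)) ⟩
  (sumTo m g′ + g′ (suc m)) + T
    ≡⟨ cong (λ c → (sumTo m g′ + ℕ→ℚ c * g (suc m)) + T) (k>n⇒nCk≡0 (ℕP.n<1+n m)) ⟩
  (sumTo m g′ + 0ℚ * g (suc m)) + T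
    ≡⟨ cong (λ t → (sumTo m g′ + t) + T) (ℚP.*-zeroˡ (g (suc m))) ⟩
  (sumTo m g′ + 0ℚ) + T
    ≡⟨ cong (_+ T) (ℚP.+-identityʳ (sumTo m g′)) ⟩
  sumTo m g′ + T ∎
  where
  open ≡-Reasoning
  g′ : ℕ → ℚ
  g′ j = ℕ→ℚ (m C j) * g j
  T : ℚ
  T = sumTo m (λ j → ℕ→ℚ (m C j) * g (suc j))
  pascal-term : ∀ j → ℕ→ℚ (suc m C suc j) * g (suc j) ≡ ℕ→ℚ (m C j) * g (suc j) + g′ (suc j)
  pascal-term j = trans (cong (λ c → ℕ→ℚ c * g (suc j)) (sym (nCk+nC[k+1]≡[n+1]C[k+1] m j)))
                 (trans (cong (_* g (suc j)) (ℕ→ℚ-+ (m C j) (m C suc j)))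
                        (ℚP.*-distribʳ-+ (g (suc j)) (ℕ→ℚ (m C j)) (ℕ→ℚ (m C suc j))))
  rearrange : ∀ a b c → a + (b + c) ≡ (a + c) + b
  rearrange = solve-∀ ℚ-ring

zpow-suc-pred : ∀ (z : ℚ) .{{_ : NonZero z}} m → zpow z (+ suc m ℤ.- + 1) ≡ z * zpow z (+ m ℤ.- + 1)
zpow-suc-pred z zero    = sym (trans (cong (z *_) (ℚP.*-identityʳ (1/ z))) (ℚP.*-inverseʳ z))
zpow-suc-pred z (suc m) = refl

wsum-BVec : ∀ N m x → wsum N m (BVec m x) ≡ sumTo m (λ j → ℕ→ℚ (N C j) * B j x)
wsum-BVec N zero    x = refl
wsum-BVec N (suc m) x = trans (cong (λ t → ℕ→ℚ (N C suc m) * B (suc m) x + t) (wsum-BVec N m x))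
                              (ℚP.+-comm _ (sumTo m (λ j → ℕ→ℚ (N C j) * B j x)))

Bernoulli-recurrence : ∀ m x → sumTo m (λ j → ℕ→ℚ (suc m C j) * B j x) ≡ ℕ→ℚ (suc m) * x ^ m
Bernoulli-recurrence zero    x = refl
Bernoulli-recurrence (suc m) x = begin
  sumTo m (λ j → ℕ→ℚ (suc (suc m) C j) * B j x) + ℕ→ℚ (suc (suc m) C suc m) * B (suc m) x
    ≡⟨ cong₂ (λ s c → s + ℕ→ℚ c * B (suc m) x) (sym (wsum-BVec (suc (suc m)) m x)) C[n+2,n+1]≡n+2 ⟩
  W + N * B (suc m) x
    ≡⟨ cong (_+ N * B (suc m) x) (sym (trans (cong (_* W) (ℕ→ℚ-suc-*-inverse (suc m))) (ℚP.*-identityˡ W))) ⟩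
  N * (+ 1 / suc (suc m)) * W + N * (x ^ suc m - (+ 1 / suc (suc m)) * W)
    ≡⟨ cancel N (+ 1 / suc (suc m)) W (x ^ suc m) ⟩
  N * x ^ suc m ∎
  where
  open ≡-Reasoning
  N : ℚ
  N = ℕ→ℚ (suc (suc m))
  W : ℚ
  W = wsum (suc (suc m)) m (BVec m x)
  C[n+2,n+1]≡n+2 : suc (suc m) C suc m ≡ suc (suc m)
  C[n+2,n+1]≡n+2 = trans (nCk≡nC[n∸k] (ℕP.n≤1+n (suc m)))
                         (trans (cong (suc (suc m) C_) (ℕP.m+n∸n≡m 1 (suc m))) (nC1≡n (suc (suc m))))
  cancel : ∀ n i w p → n * i * w + n * (p - i * w) ≡ n * p
  cancel = solve-∀ ℚ-ring

module _ (x : ℚ) where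

  shiftedSum : ℕ → ℕ → ℚ
  shiftedSum m k = sumTo m (λ j → ℕ→ℚ (m C j) * B (j ℕ.+ k) x)

  alternatingSum : ℕ → ℕ → ℚ
  alternatingSum n k = sumTo k (λ j → ℕ→ℚ (k C j) * sgn j * B (n ∸ j) x)

  shiftedSum-recurrence : ∀ m k → shiftedSum m (suc k) ≡ shiftedSum (suc m) k - shiftedSum m k
  shiftedSum-recurrence m k = begin
    shiftedSum m (suc k)
      ≡⟨ sumTo-cong m (λ j → cong (λ i → ℕ→ℚ (m C j) * B i x) (ℕP.+-suc j k)) ⟩
    S
      ≡⟨ add-sub-cancel (shiftedSum m k) S ⟩
    (shiftedSum m k + S) - shiftedSum m k
      ≡⟨ cong (_- shiftedSum m k) (sym (sumTo-pascal m (λ j → B (j ℕ.+ k) x))) ⟩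
    shiftedSum (suc m) k - shiftedSum m k ∎
    where
    open ≡-Reasoning
    S : ℚ
    S = sumTo m (λ j → ℕ→ℚ (m C j) * B (suc (j ℕ.+ k)) x)
    add-sub-cancel : ∀ a b → b ≡ (a + b) - a
    add-sub-cancel = solve-∀ ℚ-ring

  alternatingSum-recurrence : ∀ n k → alternatingSum (suc n) (suc k) ≡ alternatingSum (suc n) k - alternatingSum n k
  alternatingSum-recurrence n k = begin
    sumTo (suc k) (λ j → ℕ→ℚ (suc k C j) * sgn j * B (suc n ∸ j) x)
      ≡⟨ sumTo-cong (suc k) (λ j → ℚP.*-assoc (ℕ→ℚ (suc k C j)) (sgn j) (B (suc n ∸ j) x)) ⟩
    sumTo (suc k) (λ j → ℕ→ℚ (suc k C j) * (sgn j * B (suc n ∸ j) x))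
      ≡⟨ sumTo-pascal k (λ j → sgn j * B (suc n ∸ j) x) ⟩
    sumTo k (λ j → ℕ→ℚ (k C j) * (sgn j * B (suc n ∸ j) x)) + sumTo k (λ j → ℕ→ℚ (k C j) * (- sgn j * B (n ∸ j) x))
      ≡⟨ cong₂ _+_ (sumTo-cong k (λ j → sym (ℚP.*-assoc (ℕ→ℚ (k C j)) (sgn j) (B (suc n ∸ j) x))))
                   (trans (sumTo-cong k (λ j → pull-neg (ℕ→ℚ (k C j)) (sgn j) (B (n ∸ j) x)))
                          (sumTo-neg k (λ j → ℕ→ℚ (k C j) * sgn j * B (n ∸ j) x))) ⟩
    alternatingSum (suc n) k - alternatingSum n k ∎
    where
    open ≡-Reasoning
    pull-neg : ∀ c s b → c * (- s * b) ≡ - (c * s * b)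
    pull-neg = solve-∀ ℚ-ring

  shiftedSum-zero : ∀ m → shiftedSum (suc m) 0 ≡ B (suc m) x + ℕ→ℚ (suc m) * x ^ m
  shiftedSum-zero m = begin
    sumTo m (λ j → ℕ→ℚ (suc m C j) * B (j ℕ.+ 0) x) + ℕ→ℚ (suc m C suc m) * B (suc m ℕ.+ 0) x
      ≡⟨ cong₂ _+_ (trans (sumTo-cong m (λ j → cong (λ i → ℕ→ℚ (suc m C j) * B i x) (ℕP.+-identityʳ j)))
                          (Bernoulli-recurrence m x))
                   (cong₂ (λ c i → ℕ→ℚ c * B i x) (nCn≡1 (suc m)) (ℕP.+-identityʳ (suc m))) ⟩
    ℕ→ℚ (suc m) * x ^ m + 1ℚ * B (suc m) x
      ≡⟨ cong (λ t → ℕ→ℚ (suc m) * x ^ m + t) (ℚP.*-identityˡ (B (suc m) x)) ⟩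
    ℕ→ℚ (suc m) * x ^ m + B (suc m) x
      ≡⟨ ℚP.+-comm _ (B (suc m) x) ⟩
    B (suc m) x + ℕ→ℚ (suc m) * x ^ m ∎
    where open ≡-Reasoning

  module _ .{{_ : NonZero x}} .{{_ : NonZero (x - 1ℚ)}} where

    -- E(n,k) is correction n (n ∸ k) k; freeing d makes its recurrence unconditional.
    correction : ℕ → ℕ → ℕ → ℚ
    correction n d k = (ℕ→ℚ n * x - ℕ→ℚ d) * zpow x (+ d ℤ.- + 1) * zpow (x - 1ℚ) (+ k ℤ.- + 1)

    correction-recurrence : ∀ n d k → correction (suc n) d (suc k) ≡ correction (suc n) (suc d) k - correction n d k
    correction-recurrence n d k
      rewrite zpow-suc-pred x d | zpow-suc-pred (x - 1ℚ) k | ℕ→ℚ-suc n | ℕ→ℚ-suc d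
      = factor x (zpow x (+ d ℤ.- + 1)) (zpow (x - 1ℚ) (+ k ℤ.- + 1)) (ℕ→ℚ n) (ℕ→ℚ d)
      where
      factor : ∀ y p q a b → ((1ℚ + a) * y - b) * p * ((y - 1ℚ) * q)
                            ≡ ((1ℚ + a) * y - (1ℚ + b)) * (y * p) * q - (a * y - b) * p * q
      factor = solve-∀ ℚ-ring

    correction-zero : ∀ m → correction (suc m) (suc m) 0 ≡ ℕ→ℚ (suc m) * x ^ m
    correction-zero m = begin
      (N * x - N) * x ^ m * (1/ (x - 1ℚ) * 1ℚ)      ≡⟨ regroup N (x ^ m) x (1/ (x - 1ℚ)) ⟩
      N * x ^ m * ((x - 1ℚ) * 1/ (x - 1ℚ))         ≡⟨ cong (N * x ^ m *_) (ℚP.*-inverseʳ (x - 1ℚ)) ⟩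
      N * x ^ m * 1ℚ                                ≡⟨ ℚP.*-identityʳ (N * x ^ m) ⟩
      N * x ^ m                                     ∎
      where
      open ≡-Reasoning
      N : ℚ
      N = ℕ→ℚ (suc m)
      regroup : ∀ n p y i → (n * y - n) * p * (i * 1ℚ) ≡ n * p * ((y - 1ℚ) * i)
      regroup = solve-∀ ℚ-ring

    shiftedSum-identity₀ : ∀ n → shiftedSum n 0 ≡ alternatingSum n 0 + correction n n 0
    shiftedSum-identity₀ zero    = collapse (B 0 x) x (zpow x (+ 0 ℤ.- + 1)) (zpow (x - 1ℚ) (+ 0 ℤ.- + 1))
      where
      collapse : ∀ b y p q → 1ℚ * b ≡ 1ℚ * 1ℚ * b + (0ℚ * y - 0ℚ) * p * q
      collapse = solve-∀ ℚ-ring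
    shiftedSum-identity₀ (suc m) = begin
      shiftedSum (suc m) 0                                     ≡⟨ shiftedSum-zero m ⟩
      B (suc m) x + ℕ→ℚ (suc m) * x ^ m                        ≡⟨ cong₂ _+_ (sym (ℚP.*-identityˡ (B (suc m) x)))
                                                                            (sym (correction-zero m)) ⟩
      1ℚ * B (suc m) x + correction (suc m) (suc m) 0          ≡⟨ cong (_+ correction (suc m) (suc m) 0)
                                                                       (cong (_* B (suc m) x) (sym (ℚP.*-identityˡ 1ℚ))) ⟩
      alternatingSum (suc m) 0 + correction (suc m) (suc m) 0  ∎
      where open ≡-Reasoning

    shiftedSum-identity : ∀ k n → k ≤ n → shiftedSum (n ∸ k) k ≡ alternatingSum n k + correction n (n ∸ k) k
    shiftedSum-identity zero    n       _         = shiftedSum-identity₀ n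
    shiftedSum-identity (suc k) (suc n) (s≤s k≤n) = begin
      shiftedSum (n ∸ k) (suc k)
        ≡⟨ shiftedSum-recurrence (n ∸ k) k ⟩
      shiftedSum (suc (n ∸ k)) k - shiftedSum (n ∸ k) k
        ≡⟨ cong₂ _-_ shiftedSum-identity-suc-n (shiftedSum-identity k n k≤n) ⟩
      (R′ + E′) - (R + E)
        ≡⟨ interchange R′ E′ R E ⟩
      (R′ - R) + (E′ - E)
        ≡⟨ cong₂ _+_ (sym (alternatingSum-recurrence n k)) (sym (correction-recurrence n (n ∸ k) k)) ⟩
      alternatingSum (suc n) (suc k) + correction (suc n) (n ∸ k) (suc k) ∎
      where
      open ≡-Reasoning
      R′ R E′ E : ℚ
      R′ = alternatingSum (suc n) k
      R  = alternatingSum n k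
      E′ = correction (suc n) (suc (n ∸ k)) k
      E  = correction n (n ∸ k) k
      shiftedSum-identity-suc-n : shiftedSum (suc (n ∸ k)) k ≡ R′ + E′
      shiftedSum-identity-suc-n = subst (λ d → shiftedSum d k ≡ R′ + correction (suc n) d k)
                                        (ℕP.+-∸-assoc 1 k≤n) (shiftedSum-identity k (suc n) (ℕP.m≤n⇒m≤1+n k≤n))
      interchange : ∀ a b c d → (a + b) - (c + d) ≡ (a - c) + (b - d)
      interchange = solve-∀ ℚ-ring

theorem2p2 : (n k : ℕ) → k ≤ n → (x : ℚ) → .{{_ : NonZero x}} → .{{_ : NonZero (x - 1ℚ)}} →
    sumTo (n ∸ k) (λ j → ℕ→ℚ ((n ∸ k) C j) * B (j Data.Nat.+ k) x)
      ≡ sumTo k (λ j → ℕ→ℚ (k C j) * sgn j * B (n ∸ j) x)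
        + (ℕ→ℚ n * x - ℕ→ℚ (n ∸ k))
          * zpow x (+ (n ∸ k) Data.Integer.- + 1)
          * zpow (x - 1ℚ) (+ k Data.Integer.- + 1)
theorem2p2 n k k≤n x = shiftedSum-identity x k n k≤n
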